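{- Let $n\ge2$ and let $N:=\lceil n\ln n\rceil$. For all graphs $G$ and $H$ with $|V(G)|=|V(H)|=n$: if $\hom(S_N,G)=\hom(S_N,H)$, then $d_i(G)=d_i(H)$ for all $i\in\{0,\dots,n-1\}$, where $d_i(G)$ denotes the number of vertices of $G$ of degree $i$.
   Context: Graphs are finite, simple, undirected, with non-empty vertex set. $\hom(F,G)$ is the number of homomorphisms from $F$ to $G$. For $j\ge1$, $S_j$ is the star with $j$ vertices: one center vertex adjacent to $j-1$ further vertices of degree $1$. -}

module Defs where

open import Data.Nat using (ℕ; zero; suc; _+_; _*_; _∸_; _^_; _≤_; _<_; _≡ᵇ_; _!)
open import Data.Bool using (Bool; true; false; _∧_; _∨_; not)
open import Data.Fin using (Fin; zero; suc)
open import Data.List using (List; []; _∷_; map; concatMap; allFin; filterᵇ; length; foldr)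
open import Data.Product using (∃; _×_)
open import Relation.Binary.PropositionalEquality using (_≡_)

record Graph (n : ℕ) : Set where
  field
    adj    : Fin n → Fin n → Bool
    symm   : ∀ u v → adj u v ≡ adj v u
    irrefl : ∀ v → adj v v ≡ false
open Graph public

allᵇ : {A : Set} → (A → Bool) → List A → Bool
allᵇ p = foldr (λ a b → p a ∧ b) true

allFuns : (k n : ℕ) → List (Fin k → Fin n)
allFuns zero    n = (λ ()) ∷ []
allFuns (suc k) n =
  concatMap (λ a → map (λ f → λ { zero → a ; (suc i) → f i }) (allFuns k n)) (allFin n)

isHom : ∀ {k n} → Graph k → Graph n → (Fin k → Fin n) → Bool
isHom {k} F G f =
  allᵇ (λ i → allᵇ (λ j → not (adj F i j) ∨ adj G (f i) (f j)) (allFin k)) (allFin k)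

hom : ∀ {k n} → Graph k → Graph n → ℕ
hom {k} {n} F G = length (filterᵇ (isHom F G) (allFuns k n))

-- The star S_j on vertex set Fin j: vertex zero is the center, adjacent to
-- all other j-1 vertices (which have degree 1).  (Only used for j ≥ 1.)
starAdj : ∀ {j} → Fin j → Fin j → Bool
starAdj zero    zero    = false
starAdj zero    (suc _) = true
starAdj (suc _) zero    = true
starAdj (suc _) (suc _) = false

starSymm : ∀ {j} (u v : Fin j) → starAdj u v ≡ starAdj v u
starSymm zero    zero    = _≡_.refl
starSymm zero    (suc _) = _≡_.refl
starSymm (suc _) zero    = _≡_.refl
starSymm (suc _) (suc _) = _≡_.refl

starIrrefl : ∀ {j} (v : Fin j) → starAdj v v ≡ false
starIrrefl zero    = _≡_.refl
starIrrefl (suc _) = _≡_.refl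

Star : (j : ℕ) → Graph j
Star j = record { adj = starAdj ; symm = starSymm ; irrefl = starIrrefl }

degree : ∀ {n} → Graph n → Fin n → ℕ
degree {n} G v = length (filterᵇ (adj G v) (allFin n))

degCount : ∀ {n} → Graph n → ℕ → ℕ
degCount {n} G i = length (filterᵇ (λ v → degree G v ≡ᵇ i) (allFin n))

-- N = ⌈ n ln n ⌉, expressed without reals.
-- N = ⌈ n ln n ⌉  ⇔  N - 1 < n ln n ≤ N  ⇔  e^(N-1) < n^n ≤ e^N.
-- With the exponential series e^x = Σ_k x^k / k!, scaled by K!:
--   expScaled x K = K! · Σ_{k=0}^{K} x^k / k! = Σ_{k=0}^{K} x^k · K!/k!  (a natural number).

expScaled : ℕ → ℕ → ℕ
expScaled x zero    = 1
expScaled x (suc K) = suc K * expScaled x K + x ^ suc K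
-- (recurrence: (K+1)! Σ_{k≤K+1} x^k/k! = (K+1)·K! Σ_{k≤K} x^k/k! + x^(K+1))

-- Since e^m is irrational for m ≥ 1 and partial sums increase strictly to e^m:
--   n^n ≤ e^N      ⇔ ∃ K, n^n · K! ≤ expScaled N K
--   e^(N-1) < n^n  ⇔ ∀ K, expScaled (N ∸ 1) K < n^n · K!     (for n ≥ 2)
IsCeilNLnN : ℕ → ℕ → Set
IsCeilNLnN n N =
  (∃ λ K → n ^ n * (K !) ≤ expScaled N K) ×
  (∀ K → expScaled (N ∸ 1) K < n ^ n * (K !))

-- Counting homomorphisms from a star by the image of its centre gives
-- hom(S_{m+1}, G) = Σ_v deg(v)^m = Σ_i d_i(G) i^m, while Σ_i d_i(G) = n.  If n i^m < (1+i)^m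
-- for all 1+i < n, then at the largest degree where the counts of G and H differ, that
-- term outweighs all lower ones together, so these two sums determine every d_i.
-- For m = N - 1 this gap condition follows from n^n ≤ e^N alone: since
-- e ≤ (1+1/a)^(1+a), we get n^n ≤ (1+1/a)^(N(1+a)) for a = n - 2, and (1+1/a)^(1+a) < 2 + a
-- for a ≥ 2 (the sequence decreases from 27/8) turns this into n a^m < (1+a)^m, which
-- propagates to all smaller i.  The cases n = 2, 3 are checked directly.
module Submission where

open import Defs
open import Data.Nat
  using (ℕ; zero; suc; _+_; _*_; _^_; _!; _≡ᵇ_; _≤_; _<_; _≤?_; _<?_; NonZero; z<s; s≤s)
open import Data.Nat.Properties
open import Data.Nat.ListAction using (sum)
open import Data.Nat.Tactic.RingSolver using (solve-∀)
open import Data.Bool using (Bool; true; false; _∧_; _∨_; not; if_then_else_; T)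
open import Data.Bool.Properties using (∧-identityʳ; ∧-idem)
open import Data.Fin using (Fin; zero; suc)
import Data.Vec.Functional as Vector
open import Data.List using (List; []; _∷_; _++_; map; concatMap; allFin; filterᵇ; length)
open import Data.List.Properties
  using (filter-++; length-++; map-cong; map-tabulate; filter-notAll; length-tabulate)
open import Data.List.Membership.Propositional using (_∈_; lose)
open import Data.List.Membership.Propositional.Properties using (∈-allFin)
open import Data.Product using (∃-syntax; _×_; _,_)
open import Data.Sum using (inj₁; inj₂)
open import Function using (_∘_; id)
open import Algebra.Properties.CommutativeSemigroup +-commutativeSemigroup using (interchange)
import Algebra.Properties.CommutativeSemigroup *-commutativeSemigroup as *-CS
open import Relation.Binary.Definitions using (tri<; tri≈; tri>)
open import Relation.Binary.PropositionalEquality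
open import Relation.Nullary using (contradiction)
open import Relation.Nullary.Decidable using (T?; dec-true; dec-false; from-yes; from-no)

count : {A : Set} → (A → Bool) → List A → ℕ
count p xs = length (filterᵇ p xs)

private
  variable
    A B : Set

count-∷ : ∀ (p : A → Bool) x xs → count p (x ∷ xs) ≡ (if p x then 1 else 0) + count p xs
count-∷ p x xs with p x
... | true  = refl
... | false = refl

count-++ : ∀ (p : A → Bool) xs ys → count p (xs ++ ys) ≡ count p xs + count p ys
count-++ p xs ys = trans (cong length (filter-++ (T? ∘ p) xs ys)) (length-++ (filterᵇ p xs))

count-concatMap : ∀ (p : B → Bool) (h : A → List B) xs →
                  count p (concatMap h xs) ≡ sum (map (count p ∘ h) xs)
count-concatMap p h []       = refl
count-concatMap p h (x ∷ xs) =
  trans (count-++ p (h x) (concatMap h xs)) (cong (count p (h x) +_) (count-concatMap p h xs))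

count-map : ∀ (p : B → Bool) (g : A → B) xs → count p (map g xs) ≡ count (p ∘ g) xs
count-map p g []       = refl
count-map p g (x ∷ xs) with p (g x)
... | true  = cong suc (count-map p g xs)
... | false = count-map p g xs

count-cong : ∀ {p q : A → Bool} → (∀ x → p x ≡ q x) → ∀ xs → count p xs ≡ count q xs
count-cong e []       = refl
count-cong {p = p} {q} e (x ∷ xs) with p x | q x | e x
... | true  | true  | refl = cong suc (count-cong e xs)
... | false | false | refl = count-cong e xs

count-false : ∀ xs → count (λ (_ : A) → false) xs ≡ 0
count-false []       = refl
count-false (_ ∷ xs) = count-false xs

count-const-∧ : ∀ b (p : A → Bool) xs →
                count (λ x → b ∧ p x) xs ≡ (if b then count p xs else 0)
count-const-∧ true  p xs = refl
count-const-∧ false p xs = count-false xs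

sum-map-if : ∀ (q : A → Bool) k xs → sum (map (λ x → if q x then k else 0) xs) ≡ count q xs * k
sum-map-if q k []       = refl
sum-map-if q k (x ∷ xs) with q x
... | true  = cong (k +_) (sum-map-if q k xs)
... | false = sum-map-if q k xs

count<length : ∀ (p : A → Bool) {x xs} → x ∈ xs → p x ≡ false → count p xs < length xs
count<length p x∈xs px≡false = filter-notAll (T? ∘ p) _ (lose x∈xs (subst T px≡false))

allᵇ-cong : ∀ {p q : A → Bool} → (∀ x → p x ≡ q x) → ∀ xs → allᵇ p xs ≡ allᵇ q xs
allᵇ-cong e []       = refl
allᵇ-cong e (x ∷ xs) = cong₂ _∧_ (e x) (allᵇ-cong e xs)

allᵇ-map : ∀ (p : B → Bool) (g : A → B) xs → allᵇ p (map g xs) ≡ allᵇ (p ∘ g) xs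
allᵇ-map p g []       = refl
allᵇ-map p g (x ∷ xs) = cong (p (g x) ∧_) (allᵇ-map p g xs)

allᵇ-allFin-suc : ∀ m (p : Fin (suc m) → Bool) →
                  allᵇ p (allFin (suc m)) ≡ p zero ∧ allᵇ (p ∘ suc) (allFin m)
allᵇ-allFin-suc m p =
  cong (p zero ∧_) (trans (cong (allᵇ p) (sym (map-tabulate id suc))) (allᵇ-map p suc (allFin m)))

allᵇ-true : ∀ (xs : List A) → allᵇ (λ _ → true) xs ≡ true
allᵇ-true []       = refl
allᵇ-true (_ ∷ xs) = allᵇ-true xs

isHom-cong : ∀ {k n} (F : Graph k) (G : Graph n) {f g : Fin k → Fin n} →
             (∀ i → f i ≡ g i) → isHom F G f ≡ isHom F G g
isHom-cong {k} F G f≗g =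
  allᵇ-cong (λ i → allᵇ-cong (λ j → cong (not (adj F i j) ∨_) (cong₂ (adj G) (f≗g i) (f≗g j)))
                             (allFin k))
            (allFin k)

-- allFuns extends f by a through its own pattern lambda, which agrees pointwise with a ∷ f.
count-allFuns-suc : ∀ {m n} (p : (Fin (suc m) → Fin n) → Bool) →
                    (∀ {f g} → (∀ i → f i ≡ g i) → p f ≡ p g) →
                    count p (allFuns (suc m) n)
                      ≡ sum (map (λ a → count (λ f → p (a Vector.∷ f)) (allFuns m n)) (allFin n))
count-allFuns-suc {m} {n} p p-cong =
  trans (count-concatMap p _ (allFin n))
        (cong sum (map-cong (λ a → trans (count-map p _ (allFuns m n))
                                         (count-cong (λ f → p-cong λ { zero → refl ; (suc i) → refl })
                                                     (allFuns m n)))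
                            (allFin n)))

count-allFuns-all : ∀ m {n} (q : Fin n → Bool) →
                    count (λ f → allᵇ (q ∘ f) (allFin m)) (allFuns m n) ≡ count q (allFin n) ^ m
count-allFuns-all zero    q = refl
count-allFuns-all (suc m) {n} q = begin
    count (all-q (suc m)) (allFuns (suc m) n)
  ≡⟨ count-allFuns-suc (all-q (suc m)) (λ f≗g → allᵇ-cong (cong q ∘ f≗g) (allFin (suc m))) ⟩
    sum (map (λ a → count (λ f → all-q (suc m) (a Vector.∷ f)) (allFuns m n)) (allFin n))
  ≡⟨ cong sum (map-cong (λ a → count-cong (λ f → allᵇ-allFin-suc m (q ∘ (a Vector.∷ f)))
                                          (allFuns m n))
                        (allFin n)) ⟩
    sum (map (λ a → count (λ f → q a ∧ all-q m f) (allFuns m n)) (allFin n))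
  ≡⟨ cong sum (map-cong (λ a → count-const-∧ (q a) (all-q m) (allFuns m n)) (allFin n)) ⟩
    sum (map (λ a → if q a then count (all-q m) (allFuns m n) else 0) (allFin n))
  ≡⟨ cong (λ c → sum (map (λ a → if q a then c else 0) (allFin n))) (count-allFuns-all m q) ⟩
    sum (map (λ a → if q a then count q (allFin n) ^ m else 0) (allFin n))
  ≡⟨ sum-map-if q _ (allFin n) ⟩
    count q (allFin n) * count q (allFin n) ^ m
  ∎
  where
  open ≡-Reasoning
  all-q : ∀ k → (Fin k → Fin n) → Bool
  all-q k f = allᵇ (q ∘ f) (allFin k)

isHom-star : ∀ {m n} (G : Graph n) (g : Fin (suc m) → Fin n) →
             isHom (Star (suc m)) G g ≡ allᵇ (λ j → adj G (g zero) (g (suc j))) (allFin m)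
isHom-star {m} G g = begin
    isHom (Star (suc m)) G g
  ≡⟨ allᵇ-allFin-suc m row ⟩
    row zero ∧ allᵇ (row ∘ suc) (allFin m)
  ≡⟨ cong₂ _∧_ (allᵇ-allFin-suc m (λ j → not (starAdj zero j) ∨ adj G (g zero) (g j)))
               (allᵇ-cong leaf-row (allFin m)) ⟩
    spokes ∧ spokes
  ≡⟨ ∧-idem spokes ⟩
    spokes
  ∎
  where
  open ≡-Reasoning
  row : Fin (suc m) → Bool
  row i = allᵇ (λ j → not (starAdj i j) ∨ adj G (g i) (g j)) (allFin (suc m))
  spokes : Bool
  spokes = allᵇ (λ j → adj G (g zero) (g (suc j))) (allFin m)
  leaf-row : ∀ i → row (suc i) ≡ adj G (g zero) (g (suc i))
  leaf-row i = begin
      row (suc i)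
    ≡⟨ allᵇ-allFin-suc m (λ j → not (starAdj (suc i) j) ∨ adj G (g (suc i)) (g j)) ⟩
      adj G (g (suc i)) (g zero) ∧ allᵇ (λ _ → true) (allFin m)
    ≡⟨ cong₂ _∧_ (symm G (g (suc i)) (g zero)) (allᵇ-true (allFin m)) ⟩
      adj G (g zero) (g (suc i)) ∧ true
    ≡⟨ ∧-identityʳ _ ⟩
      adj G (g zero) (g (suc i))
    ∎

hom-star : ∀ m {n} (G : Graph n) → hom (Star (suc m)) G ≡ sum (map (λ v → degree G v ^ m) (allFin n))
hom-star m {n} G = begin
    hom (Star (suc m)) G
  ≡⟨ count-allFuns-suc (isHom (Star (suc m)) G) (isHom-cong (Star (suc m)) G) ⟩
    sum (map (λ a → count (λ f → isHom (Star (suc m)) G (a Vector.∷ f)) (allFuns m n)) (allFin n))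
  ≡⟨ cong sum (map-cong (λ a → count-cong (λ f → isHom-star G (a Vector.∷ f)) (allFuns m n))
                        (allFin n)) ⟩
    sum (map (λ a → count (λ f → allᵇ (adj G a ∘ f) (allFin m)) (allFuns m n)) (allFin n))
  ≡⟨ cong sum (map-cong (λ a → count-allFuns-all m (adj G a)) (allFin n)) ⟩
    sum (map (λ v → degree G v ^ m) (allFin n))
  ∎
  where open ≡-Reasoning

∑< : ℕ → (ℕ → ℕ) → ℕ
∑< zero    f = 0
∑< (suc k) f = ∑< k f + f k

syntax ∑< k (λ i → e) = ∑[ i < k ] e

∑-cong : ∀ k {f g : ℕ → ℕ} → (∀ i → f i ≡ g i) → ∑< k f ≡ ∑< k g
∑-cong zero    e = refl
∑-cong (suc k) e = cong₂ _+_ (∑-cong k e) (e k)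

∑-zero : ∀ k → ∑[ i < k ] 0 ≡ 0
∑-zero zero    = refl
∑-zero (suc k) = trans (+-identityʳ _) (∑-zero k)

∑-+ : ∀ k (f g : ℕ → ℕ) → ∑[ i < k ] (f i + g i) ≡ ∑< k f + ∑< k g
∑-+ zero    f g = refl
∑-+ (suc k) f g =
  trans (cong (_+ (f k + g k)) (∑-+ k f g)) (interchange (∑< k f) (∑< k g) (f k) (g k))

δ : ℕ → ℕ → ℕ
δ d i = if d ≡ᵇ i then 1 else 0

δ-≢ : ∀ {d i} → d ≢ i → δ d i ≡ 0
δ-≢ {d} {i} d≢i = cong (λ b → if b then 1 else 0) (dec-false (d ≟ i) d≢i)

δ-refl : ∀ d → δ d d ≡ 1
δ-refl d = cong (λ b → if b then 1 else 0) (dec-true (d ≟ d) refl)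

∑-δ-out : ∀ {d} k (w : ℕ → ℕ) → k ≤ d → ∑[ i < k ] (δ d i * w i) ≡ 0
∑-δ-out zero    w _   = refl
∑-δ-out (suc k) w k<d = cong₂ _+_ (∑-δ-out k w (<⇒≤ k<d)) (cong (_* w k) (δ-≢ (>⇒≢ k<d)))

∑-δ : ∀ {d} k (w : ℕ → ℕ) → d < k → ∑[ i < k ] (δ d i * w i) ≡ w d
∑-δ {d} (suc k) w d<1+k with m<1+n⇒m<n∨m≡n d<1+k
... | inj₁ d<k  =
  trans (cong₂ _+_ (∑-δ k w d<k) (cong (_* w k) (δ-≢ (<⇒≢ d<k)))) (+-identityʳ (w d))
... | inj₂ refl =
  trans (cong₂ _+_ (∑-δ-out k w ≤-refl) (cong (_* w k) (δ-refl k))) (+-identityʳ (w k))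

sum-map-by-value : ∀ k (f : A → ℕ) (w : ℕ → ℕ) → (∀ x → f x < k) → ∀ xs →
                   sum (map (w ∘ f) xs) ≡ ∑[ i < k ] (count (λ x → f x ≡ᵇ i) xs * w i)
sum-map-by-value k f w f<k []       = sym (∑-zero k)
sum-map-by-value k f w f<k (x ∷ xs) = begin
    w (f x) + sum (map (w ∘ f) xs)
  ≡⟨ cong₂ _+_ (sym (∑-δ k w (f<k x))) (sum-map-by-value k f w f<k xs) ⟩
    ∑[ i < k ] (δ (f x) i * w i) + ∑[ i < k ] (count (λ y → f y ≡ᵇ i) xs * w i)
  ≡⟨ ∑-+ k _ _ ⟨
    ∑[ i < k ] (δ (f x) i * w i + count (λ y → f y ≡ᵇ i) xs * w i)
  ≡⟨ ∑-cong k (λ i → trans (sym (*-distribʳ-+ (w i) (δ (f x) i) _))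
                            (cong (_* w i) (sym (count-∷ (λ y → f y ≡ᵇ i) x xs)))) ⟩
    ∑[ i < k ] (count (λ y → f y ≡ᵇ i) (x ∷ xs) * w i)
  ∎
  where open ≡-Reasoning

degree<n : ∀ {n} (G : Graph n) v → degree G v < n
degree<n {n} G v =
  subst (degree G v <_) (length-tabulate {n = n} id) (count<length (adj G v) (∈-allFin v) (irrefl G v))

degree-moment : ∀ m {n} (G : Graph n) →
                ∑[ i < n ] (degCount G i * i ^ m) ≡ sum (map (λ v → degree G v ^ m) (allFin n))
degree-moment m {n} G = sym (sum-map-by-value n (degree G) (_^ m) (degree<n G) (allFin n))

sum-map-1 : ∀ (xs : List A) → sum (map (λ _ → 1) xs) ≡ length xs
sum-map-1 []       = refl
sum-map-1 (_ ∷ xs) = cong suc (sum-map-1 xs)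

∑-degCount : ∀ {n} (G : Graph n) → ∑[ i < n ] degCount G i ≡ n
∑-degCount {n} G = begin
    ∑[ i < n ] degCount G i
  ≡⟨ ∑-cong n (λ i → *-identityʳ (degCount G i)) ⟨
    ∑[ i < n ] (degCount G i * i ^ 0)
  ≡⟨ degree-moment 0 G ⟩
    sum (map (λ _ → 1) (allFin n))
  ≡⟨ sum-map-1 (allFin n) ⟩
    length (allFin n)
  ≡⟨ length-tabulate {n = n} id ⟩
    n
  ∎
  where open ≡-Reasoning

PowerGap : ℕ → ℕ → ℕ → Set
PowerGap c m k = ∀ i → suc i < k → c * i ^ m < suc i ^ m

∑-moment≤ : ∀ m k (c : ℕ → ℕ) → ∑[ i < suc k ] (c i * i ^ m) ≤ ∑< (suc k) c * k ^ m
∑-moment≤ m zero    c = ≤-refl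
∑-moment≤ m (suc k) c = begin
    ∑[ i < suc k ] (c i * i ^ m) + c (suc k) * suc k ^ m
  ≤⟨ +-monoˡ-≤ _ (∑-moment≤ m k c) ⟩
    ∑< (suc k) c * k ^ m + c (suc k) * suc k ^ m
  ≤⟨ +-monoˡ-≤ _ (*-monoʳ-≤ (∑< (suc k) c) (^-monoˡ-≤ m (n≤1+n k))) ⟩
    ∑< (suc k) c * suc k ^ m + c (suc k) * suc k ^ m
  ≡⟨ *-distribʳ-+ (suc k ^ m) (∑< (suc k) c) (c (suc k)) ⟨
    ∑< (suc (suc k)) c * suc k ^ m
  ∎
  where open ≤-Reasoning

module _ (n m : ℕ) where

  moment-<-top : ∀ k (c e : ℕ → ℕ) → ∑< (suc k) c ≤ n → n * k ^ m < suc k ^ m →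
                 c (suc k) < e (suc k) →
                 ∑[ i < suc (suc k) ] (c i * i ^ m) < ∑[ i < suc (suc k) ] (e i * i ^ m)
  moment-<-top k c e total≤n gap c<e = begin-strict
      ∑[ i < suc k ] (c i * i ^ m) + c (suc k) * K
    ≤⟨ +-monoˡ-≤ _ (≤-trans (∑-moment≤ m k c) (*-monoˡ-≤ (k ^ m) total≤n)) ⟩
      n * k ^ m + c (suc k) * K
    <⟨ +-monoˡ-< _ gap ⟩
      suc (c (suc k)) * K
    ≤⟨ *-monoˡ-≤ K c<e ⟩
      e (suc k) * K
    ≤⟨ m≤n+m _ _ ⟩
      ∑[ i < suc k ] (e i * i ^ m) + e (suc k) * K
    ∎
    where
    open ≤-Reasoning
    K = suc k ^ m

  top-coefficient-≡ : ∀ k (c e : ℕ → ℕ) →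
                      ∑< (suc k) c ≡ ∑< (suc k) e → ∑< (suc k) c ≤ n →
                      ∑[ i < suc k ] (c i * i ^ m) ≡ ∑[ i < suc k ] (e i * i ^ m) →
                      PowerGap n m (suc k) → c k ≡ e k
  top-coefficient-≡ zero    c e total≡ _ _ _ = total≡
  top-coefficient-≡ (suc k) c e total≡ total≤n moment≡ gap with <-cmp (c (suc k)) (e (suc k))
  ... | tri≈ _ c≡e _ = c≡e
  ... | tri< c<e _ _ = contradiction moment≡
        (<⇒≢ (moment-<-top k c e (≤-trans (m≤m+n _ _) total≤n) (gap k ≤-refl) c<e))
  ... | tri> _ _ e<c = contradiction moment≡
        (>⇒≢ (moment-<-top k e c (≤-trans (m≤m+n _ _) (subst (_≤ n) total≡ total≤n))
                                 (gap k ≤-refl) e<c))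

  moments-determine : ∀ k (c e : ℕ → ℕ) → ∑< k c ≡ ∑< k e → ∑< k c ≤ n →
                      ∑[ i < k ] (c i * i ^ m) ≡ ∑[ i < k ] (e i * i ^ m) →
                      PowerGap n m k → ∀ i → i < k → c i ≡ e i
  moments-determine (suc k) c e total≡ total≤n moment≡ gap = peel
    where
    top≡ : c k ≡ e k
    top≡ = top-coefficient-≡ k c e total≡ total≤n moment≡ gap
    peel : ∀ i → i < suc k → c i ≡ e i
    peel i i<1+k with m<1+n⇒m<n∨m≡n i<1+k
    ... | inj₂ refl = top≡
    ... | inj₁ i<k  = moments-determine k c e
        (+-cancelʳ-≡ (c k) _ _ (trans total≡ (cong (∑< k e +_) (sym top≡))))
        (≤-trans (m≤m+n _ _) total≤n)
        (+-cancelʳ-≡ (c k * k ^ m) _ _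
          (trans moment≡ (cong (λ x → ∑[ j < k ] (e j * j ^ m) + x * k ^ m) (sym top≡))))
        (λ j 1+j<k → gap j (m<n⇒m<1+n 1+j<k)) i i<k

^-distribʳ-* : ∀ a b k → (a * b) ^ k ≡ a ^ k * b ^ k
^-distribʳ-* a b zero    = refl
^-distribʳ-* a b (suc k) =
  trans (cong (a * b *_) (^-distribʳ-* a b k)) (*-CS.interchange a b (a ^ k) (b ^ k))

binomial-upper : ∀ x j → suc x ^ suc j ≤ x ^ suc j + suc j * suc x ^ j
binomial-upper x zero    = ≤-reflexive (+-comm 1 (x * 1))
binomial-upper x (suc j) = begin
    suc x * suc x ^ suc j
  ≤⟨ *-monoʳ-≤ (suc x) (binomial-upper x j) ⟩
    suc x * (X + suc j * Y)
  ≡⟨ expand X Y x j ⟩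
    x * X + X + suc j * (suc x * Y)
  ≤⟨ +-monoˡ-≤ _ (+-monoʳ-≤ (x * X) (^-monoˡ-≤ (suc j) (n≤1+n x))) ⟩
    x * X + suc x * Y + suc j * (suc x * Y)
  ≡⟨ +-assoc (x * X) (suc x * Y) _ ⟩
    x * X + suc (suc j) * (suc x * Y)
  ∎
  where
  open ≤-Reasoning
  X = x ^ suc j
  Y = suc x ^ j
  expand : ∀ a b x j → suc x * (a + suc j * b) ≡ x * a + a + suc j * (suc x * b)
  expand = solve-∀

binomial-lower : ∀ u k → u ^ suc k + suc k * u ^ k ≤ suc u ^ suc k
binomial-lower u zero    = ≤-reflexive (+-comm (u * 1) 1)
binomial-lower u (suc k) = begin
    u * u ^ suc k + suc (suc k) * u ^ suc k
  ≤⟨ +-monoʳ-≤ (u * u ^ suc k) (m≤m+n _ (suc k * u ^ k)) ⟩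
    u * u ^ suc k + (suc (suc k) * u ^ suc k + suc k * u ^ k)
  ≡⟨ factor u (u ^ k) k ⟩
    suc u * (u ^ suc k + suc k * u ^ k)
  ≤⟨ *-monoʳ-≤ (suc u) (binomial-lower u k) ⟩
    suc u * suc u ^ suc k
  ∎
  where
  open ≤-Reasoning
  factor : ∀ u p k → u * (u * p) + (suc (suc k) * (u * p) + suc k * p) ≡ suc u * (u * p + suc k * p)
  factor = solve-∀

-- K! L^K · Σ_{k ≤ K} (x/L)^k / k!, so that expScaled = expScaledFrac 1.
expScaledFrac : ℕ → ℕ → ℕ → ℕ
expScaledFrac L x zero    = 1
expScaledFrac L x (suc K) = suc K * L * expScaledFrac L x K + x ^ suc K

expScaledFrac-zero : ∀ L K → expScaledFrac L 0 K ≡ K ! * L ^ K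
expScaledFrac-zero L zero    = refl
expScaledFrac-zero L (suc K) =
  trans (cong (λ f → suc K * L * f + 0) (expScaledFrac-zero L K)) (regroup K L (K !) (L ^ K))
  where
  regroup : ∀ K L f p → suc K * L * (f * p) + 0 ≡ (f + K * f) * (L * p)
  regroup = solve-∀

expScaledFrac-multiple : ∀ L N K → expScaledFrac L (N * L) K ≡ L ^ K * expScaled N K
expScaledFrac-multiple L N zero    = refl
expScaledFrac-multiple L N (suc K) = begin
    suc K * L * expScaledFrac L (N * L) K + (N * L) ^ suc K
  ≡⟨ cong₂ (λ f p → suc K * L * f + p) (expScaledFrac-multiple L N K) (^-distribʳ-* N L (suc K)) ⟩
    suc K * L * (L ^ K * expScaled N K) + N ^ suc K * (L * L ^ K)
  ≡⟨ regroup K L (L ^ K) (expScaled N K) (N ^ suc K) ⟩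
    L * L ^ K * (suc K * expScaled N K + N ^ suc K)
  ∎
  where
  open ≡-Reasoning
  regroup : ∀ K L p e c → suc K * L * (p * e) + c * (L * p) ≡ L * p * (suc K * e + c)
  regroup = solve-∀

-- A mean value inequality: the x-derivative of the partial sum of order K + 1 of e^(x/L)
-- is 1/L times the partial sum of order K, which increases with x.
expScaledFrac-step : ∀ L x K → expScaledFrac L (suc x) (suc K)
                               ≤ expScaledFrac L x (suc K) + suc K * expScaledFrac L (suc x) K
expScaledFrac-step L x zero    = ≤-reflexive (regroup L x)
  where
  regroup : ∀ L x → 1 * L * 1 + suc x * 1 ≡ (1 * L * 1 + x * 1) + 1 * 1
  regroup = solve-∀
expScaledFrac-step L x (suc K) = begin
    suc (suc K) * L * expScaledFrac L (suc x) (suc K) + suc x ^ suc (suc K)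
  ≤⟨ +-mono-≤ (*-monoʳ-≤ (suc (suc K) * L) (expScaledFrac-step L x K)) (binomial-upper x (suc K)) ⟩
    suc (suc K) * L * (expScaledFrac L x (suc K) + suc K * expScaledFrac L (suc x) K)
      + (x ^ suc (suc K) + suc (suc K) * suc x ^ suc K)
  ≡⟨ regroup K L (expScaledFrac L x (suc K)) (expScaledFrac L (suc x) K)
              (x ^ suc (suc K)) (suc x ^ suc K) ⟩
    (suc (suc K) * L * expScaledFrac L x (suc K) + x ^ suc (suc K))
      + suc (suc K) * (suc K * L * expScaledFrac L (suc x) K + suc x ^ suc K)
  ∎
  where
  open ≤-Reasoning
  regroup : ∀ K L a b c d → suc (suc K) * L * (a + suc K * b) + (c + suc (suc K) * d)
                           ≡ (suc (suc K) * L * a + c) + suc (suc K) * (suc K * L * b + d)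
  regroup = solve-∀

e^[x/[1+M]]≤[1+1/M]^x : ∀ M x K → expScaledFrac (suc M) x K * M ^ x ≤ K ! * suc M ^ K * suc M ^ x
e^[x/[1+M]]≤[1+1/M]^x M zero K = ≤-reflexive (cong (_* 1) (expScaledFrac-zero (suc M) K))
e^[x/[1+M]]≤[1+1/M]^x M (suc x) zero = *-monoʳ-≤ 1 (^-monoˡ-≤ (suc x) (n≤1+n M))
e^[x/[1+M]]≤[1+1/M]^x M (suc x) (suc K) = begin
    expScaledFrac L (suc x) (suc K) * (M * M ^ x)
  ≤⟨ *-monoˡ-≤ (M * M ^ x) (expScaledFrac-step L x K) ⟩
    (expScaledFrac L x (suc K) + suc K * expScaledFrac L (suc x) K) * (M * M ^ x)
  ≡⟨ regroup₁ (expScaledFrac L x (suc K)) (expScaledFrac L (suc x) K) K M (M ^ x) ⟩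
    M * (expScaledFrac L x (suc K) * M ^ x) + suc K * (expScaledFrac L (suc x) K * M ^ suc x)
  ≤⟨ +-mono-≤ (*-monoʳ-≤ M (e^[x/[1+M]]≤[1+1/M]^x M x (suc K)))
              (*-monoʳ-≤ (suc K) (e^[x/[1+M]]≤[1+1/M]^x M (suc x) K)) ⟩
    M * (suc K ! * L ^ suc K * L ^ x) + suc K * (K ! * L ^ K * L ^ suc x)
  ≡⟨ regroup₂ M K (K !) (L ^ K) (L ^ x) ⟩
    suc K ! * L ^ suc K * L ^ suc x
  ∎
  where
  open ≤-Reasoning
  L = suc M
  regroup₁ : ∀ a b K M p → (a + suc K * b) * (M * p) ≡ M * (a * p) + suc K * (b * (M * p))
  regroup₁ = solve-∀
  regroup₂ : ∀ M K f q r → M * ((f + K * f) * (suc M * q) * r) + suc K * (f * q * (suc M * r))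
                          ≡ (f + K * f) * (suc M * q) * (suc M * r)
  regroup₂ = solve-∀

eᴺ≤[1+1/M]^[N*[1+M]] : ∀ M N K → expScaled N K * M ^ (N * suc M) ≤ K ! * suc M ^ (N * suc M)
eᴺ≤[1+1/M]^[N*[1+M]] M N K = *-cancelˡ-≤ (L ^ K) {{m^n≢0 L K}} (begin
    L ^ K * (expScaled N K * M ^ x)
  ≡⟨ *-assoc (L ^ K) _ _ ⟨
    L ^ K * expScaled N K * M ^ x
  ≡⟨ cong (_* M ^ x) (expScaledFrac-multiple L N K) ⟨
    expScaledFrac L x K * M ^ x
  ≤⟨ e^[x/[1+M]]≤[1+1/M]^x M x K ⟩
    K ! * L ^ K * L ^ x
  ≡⟨ *-CS.xy∙z≈y∙xz (K !) (L ^ K) (L ^ x) ⟩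
    L ^ K * (K ! * L ^ x)
  ∎)
  where
  open ≤-Reasoning
  L = suc M
  x = N * L

nⁿ≤[1+1/M]^[N*[1+M]] : ∀ n N K → n ^ n * K ! ≤ expScaled N K →
                       ∀ M → n ^ n * M ^ (N * suc M) ≤ suc M ^ (N * suc M)
nⁿ≤[1+1/M]^[N*[1+M]] n N K nⁿ≤eᴺ M = *-cancelˡ-≤ (K !) {{K !≢0}} (begin
    K ! * (n ^ n * M ^ x)
  ≡⟨ *-CS.x∙yz≈yx∙z (K !) (n ^ n) (M ^ x) ⟩
    n ^ n * K ! * M ^ x
  ≤⟨ *-monoˡ-≤ (M ^ x) nⁿ≤eᴺ ⟩
    expScaled N K * M ^ x
  ≤⟨ eᴺ≤[1+1/M]^[N*[1+M]] M N K ⟩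
    K ! * suc M ^ x
  ∎)
  where
  open ≤-Reasoning
  x = N * suc M

[1+1/b]^[1+b]-decreasing : ∀ c → let b = suc c in suc b ^ suc b * c ^ b ≤ b ^ b * b ^ suc b
[1+1/b]^[1+b]-decreasing c = begin
    suc (suc c) ^ suc (suc c) * c ^ suc c
  ≡⟨ *-CS.xy∙z≈x∙zy (suc (suc c)) (suc (suc c) ^ suc c) (c ^ suc c) ⟩
    suc (suc c) * (c ^ suc c * suc (suc c) ^ suc c)
  ≡⟨ cong (suc (suc c) *_) (^-distribʳ-* c (suc (suc c)) (suc c)) ⟨
    suc (suc c) * u ^ suc c
  ≡⟨ +-comm (u ^ suc c) _ ⟩
    suc c * u ^ suc c + u * u ^ c
  ≤⟨ +-monoʳ-≤ (suc c * u ^ suc c)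
               (*-monoˡ-≤ (u ^ c) (≤-trans (n≤1+n u) (≤-reflexive (1+u≡[1+c]² c)))) ⟩
    suc c * u ^ suc c + suc c * suc c * u ^ c
  ≡⟨ cong (suc c * u ^ suc c +_) (*-assoc (suc c) (suc c) (u ^ c)) ⟩
    suc c * u ^ suc c + suc c * (suc c * u ^ c)
  ≡⟨ *-distribˡ-+ (suc c) (u ^ suc c) _ ⟨
    suc c * (u ^ suc c + suc c * u ^ c)
  ≤⟨ *-monoʳ-≤ (suc c) (binomial-lower u c) ⟩
    suc c * suc u ^ suc c
  ≡⟨ cong (λ v → suc c * v ^ suc c) (1+u≡[1+c]² c) ⟩
    suc c * (suc c * suc c) ^ suc c
  ≡⟨ cong (suc c *_) (^-distribʳ-* (suc c) (suc c) (suc c)) ⟩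
    suc c * (suc c ^ suc c * suc c ^ suc c)
  ≡⟨ *-CS.x∙yz≈y∙xz (suc c) (suc c ^ suc c) (suc c ^ suc c) ⟩
    suc c ^ suc c * suc c ^ suc (suc c)
  ∎
  where
  open ≤-Reasoning
  u = c * suc (suc c)
  1+u≡[1+c]² : ∀ c → suc (c * suc (suc c)) ≡ suc c * suc c
  1+u≡[1+c]² = solve-∀

[1+1/b]^[1+b]≤27/8 : ∀ c → let b = suc (suc c) in 8 * suc b ^ suc b ≤ 27 * b ^ suc b
[1+1/b]^[1+b]≤27/8 zero    = ≤-refl
[1+1/b]^[1+b]≤27/8 (suc c) = *-cancelˡ-≤ (b ^ suc b) {{m^n≢0 b (suc b)}} (begin
    b ^ suc b * (8 * suc (suc b) ^ suc (suc b))
  ≡⟨ *-CS.x∙yz≈y∙zx (b ^ suc b) 8 (suc (suc b) ^ suc (suc b)) ⟩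
    8 * (suc (suc b) ^ suc (suc b) * b ^ suc b)
  ≤⟨ *-monoʳ-≤ 8 ([1+1/b]^[1+b]-decreasing b) ⟩
    8 * (suc b ^ suc b * suc b ^ suc (suc b))
  ≡⟨ *-assoc 8 (suc b ^ suc b) _ ⟨
    8 * suc b ^ suc b * suc b ^ suc (suc b)
  ≤⟨ *-monoˡ-≤ (suc b ^ suc (suc b)) ([1+1/b]^[1+b]≤27/8 c) ⟩
    27 * b ^ suc b * suc b ^ suc (suc b)
  ≡⟨ *-CS.xy∙z≈y∙xz 27 (b ^ suc b) _ ⟩
    b ^ suc b * (27 * suc b ^ suc (suc b))
  ∎)
  where
  open ≤-Reasoning
  b = suc (suc c)

[1+1/a]^[1+a]<2+a : ∀ c → let a = suc (suc c) in suc a ^ suc a < suc (suc a) * a ^ suc a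
[1+1/a]^[1+a]<2+a c = *-cancelˡ-< 8 _ _ (begin-strict
    8 * suc a ^ suc a
  ≤⟨ [1+1/b]^[1+b]≤27/8 c ⟩
    27 * a ^ suc a
  <⟨ *-monoˡ-< (a ^ suc a) {{m^n≢0 a (suc a)}} (from-yes (27 <? 32)) ⟩
    32 * a ^ suc a
  ≡⟨ *-assoc 8 4 (a ^ suc a) ⟩
    8 * (4 * a ^ suc a)
  ≤⟨ *-monoʳ-≤ 8 (*-monoˡ-≤ (a ^ suc a) (m≤m+n 4 c)) ⟩
    8 * (suc (suc a) * a ^ suc a)
  ∎)
  where
  open ≤-Reasoning
  a = suc (suc c)

-- i/(1+i) ≤ a/(1+a) for i ≤ a, so a gap at the top propagates downwards.
powerGap-from-top : ∀ c m a → c * a ^ m < suc a ^ m → PowerGap c m (suc (suc a))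
powerGap-from-top c m a top i (s≤s (s≤s i≤a)) =
  *-cancelʳ-< (suc a ^ m) (c * i ^ m) (suc i ^ m) (begin-strict
    c * i ^ m * suc a ^ m
  ≡⟨ *-assoc c (i ^ m) (suc a ^ m) ⟩
    c * (i ^ m * suc a ^ m)
  ≡⟨ cong (c *_) (^-distribʳ-* i (suc a) m) ⟨
    c * (i * suc a) ^ m
  ≤⟨ *-monoʳ-≤ c (^-monoˡ-≤ m i[1+a]≤[1+i]a) ⟩
    c * (suc i * a) ^ m
  ≡⟨ cong (c *_) (^-distribʳ-* (suc i) a m) ⟩
    c * (suc i ^ m * a ^ m)
  ≡⟨ *-CS.x∙yz≈y∙xz c (suc i ^ m) (a ^ m) ⟩
    suc i ^ m * (c * a ^ m)
  <⟨ *-monoʳ-< (suc i ^ m) {{m^n≢0 (suc i) m}} top ⟩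
    suc i ^ m * suc a ^ m
  ∎)
  where
  open ≤-Reasoning
  i[1+a]≤[1+i]a : i * suc a ≤ suc i * a
  i[1+a]≤[1+i]a = subst (_≤ suc i * a) (sym (*-suc i a)) (+-monoˡ-≤ (i * a) i≤a)

-- Raising (1+a)^m ≤ (2+a) a^m to the power 1+a and using (1+1/a)^(1+a) < 2+a contradicts the bound.
top-gap-large : ∀ a m .{{_ : NonZero a}} → suc a ^ suc a < suc (suc a) * a ^ suc a →
                suc (suc a) ^ suc (suc a) * a ^ (suc m * suc a) ≤ suc a ^ (suc m * suc a) →
                suc (suc a) * a ^ m < suc a ^ m
top-gap-large a m euler bound = ≰⇒> λ b^m≤na^m → <⇒≱ (b^[[1+m]b]<nⁿa^[[1+m]b] b^m≤na^m) bound
  where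
  b = suc a
  n = suc b
  b^[[1+m]b]<nⁿa^[[1+m]b] : b ^ m ≤ n * a ^ m → b ^ (suc m * b) < n ^ n * a ^ (suc m * b)
  b^[[1+m]b]<nⁿa^[[1+m]b] b^m≤na^m = begin-strict
      b ^ (b + m * b)
    ≡⟨ ^-distribˡ-+-* b b (m * b) ⟩
      b ^ b * b ^ (m * b)
    ≡⟨ cong (b ^ b *_) (^-*-assoc b m b) ⟨
      b ^ b * (b ^ m) ^ b
    ≤⟨ *-monoʳ-≤ (b ^ b) (^-monoˡ-≤ b b^m≤na^m) ⟩
      b ^ b * (n * a ^ m) ^ b
    ≡⟨ cong (b ^ b *_) (trans (^-distribʳ-* n (a ^ m) b) (cong (n ^ b *_) (^-*-assoc a m b))) ⟩
      b ^ b * (n ^ b * a ^ (m * b))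
    <⟨ *-monoˡ-< (n ^ b * a ^ (m * b))
                 {{m*n≢0 (n ^ b) (a ^ (m * b)) {{m^n≢0 n b}} {{m^n≢0 a (m * b)}}}} euler ⟩
      n * a ^ b * (n ^ b * a ^ (m * b))
    ≡⟨ *-CS.interchange n (a ^ b) (n ^ b) (a ^ (m * b)) ⟩
      n ^ n * (a ^ b * a ^ (m * b))
    ≡⟨ cong (n ^ n *_) (^-distribˡ-+-* a b (m * b)) ⟨
      n ^ n * a ^ (b + m * b)
    ∎
    where open ≤-Reasoning

top-gap : ∀ a m →
          (∀ M → suc (suc a) ^ suc (suc a) * M ^ (suc m * suc M) ≤ suc M ^ (suc m * suc M)) →
          suc (suc a) * a ^ m < suc a ^ m
top-gap 0 0                   bound = contradiction (bound 2) (from-no (32 ≤? 27))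
top-gap 0 (suc m)             _     = m^n>0 1 (suc m)
top-gap 1 0                   bound = contradiction (bound 1) (from-no (27 ≤? 4))
top-gap 1 1                   bound = contradiction (bound 1) (from-no (27 ≤? 16))
top-gap 1 (suc (suc m))       _     =
  subst (_< 2 ^ (2 + m)) (cong (3 *_) (sym (^-zeroˡ (2 + m)))) (^-monoʳ-≤ 2 (m≤m+n 2 m))
top-gap a@(suc (suc c)) m     bound = top-gap-large a m ([1+1/a]^[1+a]<2+a c) (bound a)

powerGap-of-nⁿ≤eᴺ : ∀ n N K → 2 ≤ n → n ^ n * K ! ≤ expScaled N K →
                    ∃[ m ] N ≡ suc m × PowerGap n m n
powerGap-of-nⁿ≤eᴺ 1 _ _ (s≤s ()) _
powerGap-of-nⁿ≤eᴺ n@(suc (suc a)) zero K 2≤n nⁿ≤eᴺ =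
  contradiction (nⁿ≤[1+1/M]^[N*[1+M]] n 0 K nⁿ≤eᴺ 0)
                (<⇒≱ (subst (1 <_) (sym (*-identityʳ (n ^ n))) (^-monoʳ-< n 2≤n {0} {n} z<s)))
powerGap-of-nⁿ≤eᴺ n@(suc (suc a)) (suc m) K _ nⁿ≤eᴺ =
  m , refl , powerGap-from-top n m a (top-gap a m (nⁿ≤[1+1/M]^[N*[1+M]] n (suc m) K nⁿ≤eᴺ))

∑-degCount-moment : ∀ m {n} (G : Graph n) → ∑[ i < n ] (degCount G i * i ^ m) ≡ hom (Star (suc m)) G
∑-degCount-moment m G = trans (degree-moment m G) (sym (hom-star m G))

-- Only the lower bound N ≥ n ln n, i.e. n^n ≤ e^N, is used.
proposition7p2 : (n : ℕ) → 2 ≤ n → (N : ℕ) → IsCeilNLnN n N →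
    (G H : Graph n) → hom (Star N) G ≡ hom (Star N) H →
    (i : ℕ) → i < n → degCount G i ≡ degCount H i
proposition7p2 n 2≤n N ((K , nⁿ≤eᴺ) , _) G H hom≡
  with powerGap-of-nⁿ≤eᴺ n N K 2≤n nⁿ≤eᴺ
... | m , refl , gap =
  moments-determine n m n (degCount G) (degCount H)
    (trans (∑-degCount G) (sym (∑-degCount H)))
    (≤-reflexive (∑-degCount G))
    (trans (∑-degCount-moment m G) (trans hom≡ (sym (∑-degCount-moment m H))))
    gap
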